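{- Let $\mathcal{A}=(\mathbb{N},S^{\mathcal{A}})$ be a punctual copy of $(\mathbb{N},S)$ such that the image $+^{\mathcal{A}}$ of addition in $\mathcal{A}$ is primitive recursive, and let $\widetilde{\mathcal{A}}$ be the copy obtained from $\mathcal{A}$ by the binary-expansion construction. Then the image $\cdot^{\widetilde{\mathcal{A}}}$ of multiplication in $\widetilde{\mathcal{A}}$ is primitive recursive.
   Context: $S$ is the successor on $\mathbb{N}$. A punctual copy of $(\mathbb{N},S)$ is $\mathcal{A}=(\mathbb{N},S^{\mathcal{A}})$ isomorphic to $(\mathbb{N},S)$ with $S^{\mathcal{A}}$ primitive recursive; let $c:(\mathbb{N},S)\to\mathcal{A}$ be the isomorphism. For $f:\mathbb{N}^k\to\mathbb{N}$ its image in a copy with isomorphism $d$ is $(x_1,\dots,x_k)\mapsto d(f(d^{ -1}(x_1),\dots,d^{ -1}(x_k)))$; so $x+^{\mathcal{A}}y = c(c^{ -1}(x)+c^{ -1}(y))$. Define $\widetilde{c}:\mathbb{N}\to\mathbb{N}$ by $\widetilde{c}(0)=0$ and $\widetilde{c}(2^{i_k}+\dots+2^{i_0}) = 2^{c(i_k)}+\dots+2^{c(i_0)}$ for distinct $i_k>\dots>i_0$. $\widetilde{\mathcal{A}}=(\mathbb{N},S^{\widetilde{\mathcal{A}}})$ is the copy of $(\mathbb{N},S)$ with isomorphism $\widetilde{c}$, i.e. $S^{\widetilde{\mathcal{A}}}(\widetilde{c}(n))=\widetilde{c}(n+1)$, and $x\cdot^{\widetilde{\mathcal{A}}}y=\widetilde{c}(\widetilde{c}^{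 -1}(x)\cdot\widetilde{c}^{ -1}(y))$. -}

module Defs where

open import Data.Nat using (ℕ; zero; suc; _+_; _*_; _^_)
open import Data.Nat.DivMod using (_/_; _%_)
open import Data.Fin using (Fin)
open import Data.Vec using (Vec; []; _∷_; lookup)
open import Data.Product using (Σ)
open import Relation.Binary.PropositionalEquality using (_≡_)
open import Function.Bundles using (_↔_; Inverse)

data PR : ℕ → Set where
  zeroF : PR 0
  succF : PR 1
  projF : ∀ {k} → Fin k → PR k
  compF : ∀ {k m} → PR m → Vec (PR k) m → PR k
  recF  : ∀ {k} → PR k → PR (suc (suc k)) → PR (suc k)

mutual
  eval : ∀ {k} → PR k → Vec ℕ k → ℕ
  eval zeroF _ = 0
  eval succF (x ∷ []) = suc x
  eval (projF i) xs = lookup xs i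
  eval (compF f gs) xs = eval f (evalVec gs xs)
  eval (recF g h) (zero ∷ xs) = eval g xs
  eval (recF g h) (suc n ∷ xs) = eval h (n ∷ eval (recF g h) (n ∷ xs) ∷ xs)

  evalVec : ∀ {k m} → Vec (PR k) m → Vec ℕ k → Vec ℕ m
  evalVec [] xs = []
  evalVec (g ∷ gs) xs = eval g xs ∷ evalVec gs xs

IsPrimRec : (k : ℕ) → (Vec ℕ k → ℕ) → Set
IsPrimRec k f = Σ (PR k) λ p → ∀ xs → eval p xs ≡ f xs

IsPrimRec₁ : (ℕ → ℕ) → Set
IsPrimRec₁ f = IsPrimRec 1 λ { (x ∷ []) → f x }

IsPrimRec₂ : (ℕ → ℕ → ℕ) → Set
IsPrimRec₂ f = IsPrimRec 2 λ { (x ∷ y ∷ []) → f x y }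

bit : ℕ → ℕ → ℕ
bit n zero = n % 2
bit n (suc i) = bit (n / 2) i

sumBelow : ℕ → (ℕ → ℕ) → ℕ
sumBelow zero f = 0
sumBelow (suc m) f = sumBelow m f + f m

-- binary-expansion construction: for n = 2^{i_k}+...+2^{i_0},
-- tilde g n = 2^{g i_k} + ... + 2^{g i_0}   (all bits of n lie below n).
tilde : (ℕ → ℕ) → ℕ → ℕ
tilde g n = sumBelow n λ i → bit n i * 2 ^ g i

-- A copy of (ℕ,S) given by an isomorphism c : (ℕ,S) → (ℕ,S^A), c a bijection of ℕ.
module Copy (c : ℕ ↔ ℕ) where
  c→ : ℕ → ℕ
  c→ = Inverse.to c
  c← : ℕ → ℕ
  c← = Inverse.from c

  SA : ℕ → ℕ
  SA x = c→ (suc (c← x))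

  plusA : ℕ → ℕ → ℕ
  plusA x y = c→ (c← x + c← y)

  c̃ : ℕ → ℕ
  c̃ = tilde c→
  c̃⁻¹ : ℕ → ℕ
  c̃⁻¹ = tilde c←

  timesÃ : ℕ → ℕ → ℕ
  timesÃ x y = c̃ (c̃⁻¹ x * c̃⁻¹ y)

{-# OPTIONS --safe #-}
-- Write c̃⁻¹ x = Σ_{bit x i = 1} 2^(c⁻¹ i). Then c̃⁻¹ x · c̃⁻¹ y is the sum of the powers
-- 2^(c⁻¹ i + c⁻¹ j) = 2^(c⁻¹ (i +^𝒜 j)) over the set bits i of x and j of y, so x ·^Ã y is
-- obtained from 0 by adding, in Ã, the power 2^(i +^𝒜 j) for each such pair. Adding one power
-- 2^q to a in Ã is binary addition with carry along the positions q, S^𝒜 q, S^𝒜 (S^𝒜 q), ...;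
-- every carrying step clears a set bit of a, so a + 1 steps suffice. Hence x ·^Ã y is computed
-- by bounded loops from S^𝒜, +^𝒜 and bit arithmetic.

module Submission where

open import Defs
open import Data.Nat
  using ( ℕ; zero; suc; _+_; _*_; _∸_; _^_; pred; _≟_
        ; _≤_; _<_; _>_; z≤n; s≤s; z<s; _≤′_; ≤′-refl; ≤′-step; >-nonZero)
open import Data.Nat.Properties
open import Data.Nat.DivMod
open import Data.Nat.Divisibility using (divides-refl)
open import Data.Nat.Induction using (<-rec)
open import Data.Nat.GeneralisedArithmetic using (fold; iterate; iterate-is-fold)
open import Algebra.Properties.CommutativeSemigroup +-commutativeSemigroup using (interchange)
open import Data.Fin using (Fin; #_)
open import Data.Vec using (Vec; []; _∷_; lookup; map)
open import Data.Vec.Relation.Unary.All using (All; []; _∷_)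
open import Data.Product using (_×_; _,_; ∃-syntax)
open import Data.Sum using (_⊎_; inj₁; inj₂)
open import Function.Base using (_∘_)
open import Function.Bundles using (_↔_; Inverse)
open import Function.Definitions using (Injective)
open import Relation.Nullary using (yes; no; contradiction)
open import Relation.Binary.PropositionalEquality

private
  variable
    k m : ℕ

primRec-≗ : {f g : Vec ℕ k → ℕ} → IsPrimRec k f → f ≗ g → IsPrimRec k g
primRec-≗ (p , p≗f) f≗g = p , λ xs → trans (p≗f xs) (f≗g xs)

proj-primRec : (i : Fin k) → IsPrimRec k (λ xs → lookup xs i)
proj-primRec i = projF i , λ _ → refl

comp-primRec : {f : Vec ℕ m → ℕ} {gs : Vec (Vec ℕ k → ℕ) m} →
  IsPrimRec m f → All (IsPrimRec k) gs → IsPrimRec k (λ xs → f (map (λ g → g xs) gs))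
comp-primRec {k = k} {f = f} (p , p≗f) qs =
  compF p (codes qs) , λ xs → trans (p≗f _) (cong f (evalVec-codes qs xs))
  where
  codes : ∀ {m} {gs : Vec (Vec ℕ k → ℕ) m} → All (IsPrimRec k) gs → Vec (PR k) m
  codes [] = []
  codes ((q , _) ∷ qs) = q ∷ codes qs
  evalVec-codes : ∀ {m} {gs : Vec (Vec ℕ k → ℕ) m} (qs : All (IsPrimRec k) gs) xs →
    evalVec (codes qs) xs ≡ map (λ g → g xs) gs
  evalVec-codes [] xs = refl
  evalVec-codes ((_ , q≗g) ∷ qs) xs = cong₂ _∷_ (q≗g xs) (evalVec-codes qs xs)

rec-primRec : {g : Vec ℕ k → ℕ} {h : Vec ℕ (suc (suc k)) → ℕ} (f : Vec ℕ (suc k) → ℕ) →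
  IsPrimRec k g → IsPrimRec (suc (suc k)) h →
  (∀ xs → f (0 ∷ xs) ≡ g xs) → (∀ n xs → f (suc n ∷ xs) ≡ h (n ∷ f (n ∷ xs) ∷ xs)) →
  IsPrimRec (suc k) f
rec-primRec {g = g} {h} f (p , p≗g) (q , q≗h) f-zero f-suc = recF p q , r≗f
  where
  r≗f : ∀ xs → eval (recF p q) xs ≡ f xs
  r≗f (zero ∷ xs) = trans (p≗g xs) (sym (f-zero xs))
  r≗f (suc n ∷ xs) =
    trans (q≗h _) (trans (cong (λ r → h (n ∷ r ∷ xs)) (r≗f (n ∷ xs))) (sym (f-suc n xs)))

suc-primRec : IsPrimRec₁ suc
suc-primRec = succF , λ { (_ ∷ []) → refl }

const-primRec : ∀ n → IsPrimRec k (λ _ → n)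
const-primRec zero = comp-primRec (zeroF , λ _ → refl) []
const-primRec (suc n) = comp-primRec suc-primRec (const-primRec n ∷ [])

+-primRec : IsPrimRec₂ _+_
+-primRec = primRec-≗
  (rec-primRec (λ { (n ∷ x ∷ []) → n + x }) (proj-primRec (# 0))
    (comp-primRec suc-primRec (proj-primRec (# 1) ∷ []))
    (λ { (_ ∷ []) → refl }) (λ { _ (_ ∷ []) → refl }))
  (λ { (_ ∷ _ ∷ []) → refl })

*-primRec : IsPrimRec₂ _*_
*-primRec = primRec-≗
  (rec-primRec (λ { (n ∷ x ∷ []) → n * x }) (const-primRec 0)
    (comp-primRec +-primRec (proj-primRec (# 2) ∷ proj-primRec (# 1) ∷ []))
    (λ { (_ ∷ []) → refl }) (λ { _ (_ ∷ []) → refl }))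
  (λ { (_ ∷ _ ∷ []) → refl })

pred-primRec : IsPrimRec₁ pred
pred-primRec = primRec-≗
  (rec-primRec (λ { (n ∷ []) → pred n }) (const-primRec 0) (proj-primRec (# 0))
    (λ { [] → refl }) (λ { _ [] → refl }))
  (λ { (_ ∷ []) → refl })

∸-primRec : IsPrimRec₂ _∸_
∸-primRec = primRec-≗
  (comp-primRec
    (rec-primRec (λ { (n ∷ m ∷ []) → m ∸ n }) (proj-primRec (# 0))
      (comp-primRec pred-primRec (proj-primRec (# 1) ∷ []))
      (λ { (_ ∷ []) → refl }) (λ { n (m ∷ []) → sym (pred[m∸n]≡m∸[1+n] m n) }))
    (proj-primRec (# 1) ∷ proj-primRec (# 0) ∷ []))
  (λ { (_ ∷ _ ∷ []) → refl })

2^-primRec : IsPrimRec₁ (2 ^_)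
2^-primRec = primRec-≗
  (rec-primRec (λ { (n ∷ []) → 2 ^ n }) (const-primRec 1)
    (comp-primRec *-primRec (const-primRec 2 ∷ proj-primRec (# 1) ∷ []))
    (λ { [] → refl }) (λ { _ [] → refl }))
  (λ { (_ ∷ []) → refl })

ifZero_then_else_ : ℕ → ℕ → ℕ → ℕ
ifZero zero then b else c = b
ifZero suc _ then b else c = c

ifZero-≡0 : ∀ {b x y} → b ≡ 0 → (ifZero b then x else y) ≡ x
ifZero-≡0 refl = refl

ifZero-≡1 : ∀ {b x y} → b ≡ 1 → (ifZero b then x else y) ≡ y
ifZero-≡1 refl = refl

ifZero-primRec : IsPrimRec 3 (λ { (a ∷ b ∷ c ∷ []) → ifZero a then b else c })
ifZero-primRec = rec-primRec _ (proj-primRec (# 0)) (proj-primRec (# 3))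
  (λ { (_ ∷ _ ∷ []) → refl }) (λ { _ (_ ∷ _ ∷ []) → refl })

%2-suc : ∀ n → suc n % 2 ≡ 1 ∸ n % 2
%2-suc zero = refl
%2-suc (suc zero) = refl
%2-suc (suc (suc n)) = %2-suc n

/2-suc : ∀ n → suc n / 2 ≡ n / 2 + n % 2
/2-suc zero = refl
/2-suc (suc zero) = refl
/2-suc (suc (suc n)) = begin
  suc (suc (suc n)) / 2   ≡⟨ /2-plus2 (suc n) ⟩
  suc (suc n / 2)         ≡⟨ cong suc (/2-suc n) ⟩
  suc (n / 2 + n % 2)     ≡⟨ cong (_+ n % 2) (/2-plus2 n) ⟨
  suc (suc n) / 2 + n % 2 ∎
  where
  open ≡-Reasoning
  /2-plus2 : ∀ m → suc (suc m) / 2 ≡ suc (m / 2)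
  /2-plus2 m = m/n≡1+[m∸n]/n {suc (suc m)} {2} (s≤s (s≤s z≤n))

%2-primRec : IsPrimRec₁ (_% 2)
%2-primRec = primRec-≗
  (rec-primRec (λ { (n ∷ []) → n % 2 }) (const-primRec 0)
    (comp-primRec ∸-primRec (const-primRec 1 ∷ proj-primRec (# 1) ∷ []))
    (λ { [] → refl }) (λ { n [] → %2-suc n }))
  (λ { (_ ∷ []) → refl })

/2-primRec : IsPrimRec₁ (_/ 2)
/2-primRec = primRec-≗
  (rec-primRec (λ { (n ∷ []) → n / 2 }) (const-primRec 0)
    (comp-primRec +-primRec (proj-primRec (# 1) ∷ comp-primRec %2-primRec (proj-primRec (# 0) ∷ []) ∷ []))
    (λ { [] → refl }) (λ { n [] → /2-suc n }))
  (λ { (_ ∷ []) → refl })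

bit≡iterate : ∀ n i → bit n i ≡ iterate (_/ 2) n i % 2
bit≡iterate n zero = refl
bit≡iterate n (suc i) = bit≡iterate (n / 2) i

bit-primRec : IsPrimRec₂ bit
bit-primRec = primRec-≗
  (comp-primRec %2-primRec (comp-primRec halvings (proj-primRec (# 1) ∷ proj-primRec (# 0) ∷ []) ∷ []))
  (λ { (n ∷ i ∷ []) → sym (trans (bit≡iterate n i) (cong (_% 2) (sym (iterate-is-fold n (_/ 2) i)))) })
  where
  halvings : IsPrimRec 2 (λ { (i ∷ n ∷ []) → fold n (_/ 2) i })
  halvings = rec-primRec _ (proj-primRec (# 0)) (comp-primRec /2-primRec (proj-primRec (# 1) ∷ []))
    (λ { (_ ∷ []) → refl }) (λ { _ (_ ∷ []) → refl })

bit<2 : ∀ n i → bit n i < 2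
bit<2 n zero = m%n<n n 2
bit<2 n (suc i) = bit<2 (n / 2) i

bit≡0⊎bit≡1 : ∀ n i → bit n i ≡ 0 ⊎ bit n i ≡ 1
bit≡0⊎bit≡1 n i with bit n i | bit<2 n i
... | 0 | _ = inj₁ refl
... | 1 | _ = inj₂ refl
... | suc (suc _) | s≤s (s≤s ())

n≤i⇒bit≡0 : ∀ {n i} → n ≤ i → bit n i ≡ 0
n≤i⇒bit≡0 {zero} {zero} _ = refl
n≤i⇒bit≡0 {zero} {suc i} _ = n≤i⇒bit≡0 {0} {i} z≤n
n≤i⇒bit≡0 {suc n} {suc i} (s≤s n≤i) =
  n≤i⇒bit≡0 {suc n / 2} {i} (≤-trans (≤-pred (m/n<m (suc n) 2 (s≤s (s≤s z≤n)))) n≤i)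

δ : ℕ → ℕ → ℕ
δ zero zero = 1
δ zero (suc _) = 0
δ (suc _) zero = 0
δ (suc i) (suc j) = δ i j

δ-refl : ∀ i → δ i i ≡ 1
δ-refl zero = refl
δ-refl (suc i) = δ-refl i

δ-≢ : ∀ {i j} → i ≢ j → δ i j ≡ 0
δ-≢ {zero} {zero} i≢j = contradiction refl i≢j
δ-≢ {zero} {suc _} _ = refl
δ-≢ {suc _} {zero} _ = refl
δ-≢ {suc i} {suc j} i≢j = δ-≢ (i≢j ∘ cong suc)

δ-injective-invariant : {g : ℕ → ℕ} → Injective _≡_ _≡_ g → ∀ i j → δ (g i) (g j) ≡ δ i j
δ-injective-invariant {g} g-inj i j with i ≟ j
... | yes refl = trans (δ-refl (g i)) (sym (δ-refl i))
... | no i≢j = trans (δ-≢ (i≢j ∘ g-inj)) (sym (δ-≢ i≢j))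

[m+2^[1+p]]%2≡m%2 : ∀ m p → (m + 2 ^ suc p) % 2 ≡ m % 2
[m+2^[1+p]]%2≡m%2 m p = trans (cong (λ x → (m + x) % 2) (*-comm 2 (2 ^ p))) ([m+kn]%n≡m%n m (2 ^ p) 2)

[m+2^[1+p]]/2≡m/2+2^p : ∀ m p → (m + 2 ^ suc p) / 2 ≡ m / 2 + 2 ^ p
[m+2^[1+p]]/2≡m/2+2^p m p = begin
  (m + 2 ^ suc p) / 2   ≡⟨ cong (λ x → (m + x) / 2) (*-comm 2 (2 ^ p)) ⟩
  (m + 2 ^ p * 2) / 2   ≡⟨ +-distrib-/-∣ʳ m (divides-refl (2 ^ p)) ⟩
  m / 2 + 2 ^ p * 2 / 2 ≡⟨ cong (m / 2 +_) (m*n/n≡m (2 ^ p) 2) ⟩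
  m / 2 + 2 ^ p         ∎
  where open ≡-Reasoning

bit-+2^ : ∀ {S} p j → bit S p ≡ 0 → bit (S + 2 ^ p) j ≡ bit S j + δ j p
bit-+2^ {S} zero zero S₀≡0 = begin
  (S + 1) % 2           ≡⟨ %-distribˡ-+ S 1 2 ⟩
  (S % 2 + 1) % 2       ≡⟨ cong (λ b → (b + 1) % 2) S₀≡0 ⟩
  1                     ≡⟨ cong (_+ 1) S₀≡0 ⟨
  S % 2 + 1             ∎
  where open ≡-Reasoning
bit-+2^ {S} zero (suc j) S₀≡0 = begin
  bit ((S + 1) / 2) j   ≡⟨ cong (λ x → bit x j) (+-distrib-/ S 1 S%2+1<2) ⟩
  bit (S / 2 + 0) j     ≡⟨ cong (λ x → bit x j) (+-identityʳ (S / 2)) ⟩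
  bit (S / 2) j         ≡⟨ +-identityʳ _ ⟨
  bit (S / 2) j + 0     ∎
  where
  open ≡-Reasoning
  S%2+1<2 : S % 2 + 1 < 2
  S%2+1<2 = subst (λ b → b + 1 < 2) (sym S₀≡0) ≤-refl
bit-+2^ {S} (suc p) zero _ = trans ([m+2^[1+p]]%2≡m%2 S p) (sym (+-identityʳ (S % 2)))
bit-+2^ {S} (suc p) (suc j) Sₚ≡0 =
  trans (cong (λ x → bit x j) ([m+2^[1+p]]/2≡m/2+2^p S p)) (bit-+2^ {S / 2} p j Sₚ≡0)

bit≡1⇒split : ∀ {a} p → bit a p ≡ 1 → ∃[ S ] a ≡ S + 2 ^ p × bit S p ≡ 0
bit≡1⇒split {a} zero a₀≡1 = a / 2 * 2 , a≡ , m*n%n≡0 (a / 2) 2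
  where
  a≡ : a ≡ a / 2 * 2 + 1
  a≡ = trans (m≡m%n+[m/n]*n a 2) (trans (cong (_+ a / 2 * 2) a₀≡1) (+-comm 1 (a / 2 * 2)))
bit≡1⇒split {a} (suc p) aₚ≡1 with bit≡1⇒split {a / 2} p aₚ≡1
... | S , a/2≡ , Sₚ≡0 = a % 2 + S * 2 , a≡ , trans (cong (λ x → bit x p) [a%2+S*2]/2≡S) Sₚ≡0
  where
  open ≡-Reasoning
  [a%2+S*2]/2≡S : (a % 2 + S * 2) / 2 ≡ S
  [a%2+S*2]/2≡S = begin
    (a % 2 + S * 2) / 2   ≡⟨ +-distrib-/-∣ʳ (a % 2) (divides-refl S) ⟩
    a % 2 / 2 + S * 2 / 2 ≡⟨ cong₂ _+_ (m<n⇒m/n≡0 (m%n<n a 2)) (m*n/n≡m S 2) ⟩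
    S                     ∎
  a≡ : a ≡ a % 2 + S * 2 + 2 ^ suc p
  a≡ = begin
    a                             ≡⟨ m≡m%n+[m/n]*n a 2 ⟩
    a % 2 + a / 2 * 2             ≡⟨ cong (λ x → a % 2 + x * 2) a/2≡ ⟩
    a % 2 + (S + 2 ^ p) * 2       ≡⟨ cong (a % 2 +_) (*-distribʳ-+ 2 S (2 ^ p)) ⟩
    a % 2 + (S * 2 + 2 ^ p * 2)   ≡⟨ +-assoc (a % 2) (S * 2) (2 ^ p * 2) ⟨
    a % 2 + S * 2 + 2 ^ p * 2     ≡⟨ cong (a % 2 + S * 2 +_) (*-comm (2 ^ p) 2) ⟩
    a % 2 + S * 2 + 2 ^ suc p     ∎

>0⇒∃bit≡1 : ∀ n → n > 0 → ∃[ p ] bit n p ≡ 1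
>0⇒∃bit≡1 = <-rec _ step
  where
  step : ∀ n → (∀ {m} → m < n → m > 0 → ∃[ p ] bit m p ≡ 1) → n > 0 → ∃[ p ] bit n p ≡ 1
  step n rec n>0 with bit≡0⊎bit≡1 n 0
  ... | inj₂ n₀≡1 = 0 , n₀≡1
  ... | inj₁ n₀≡0 with rec (m/n<m n 2 {{>-nonZero n>0}} (s≤s (s≤s z≤n))) (n≢0⇒n>0 n/2≢0)
    where
    n/2≢0 : n / 2 ≢ 0
    n/2≢0 n/2≡0 = >⇒≢ n>0 (trans (m≡m%n+[m/n]*n n 2) (cong₂ (λ r q → r + q * 2) n₀≡0 n/2≡0))
  ...   | p , bit≡1 = suc p , bit≡1

bitInduction : (P : ℕ → Set) → P 0 → (∀ S p → bit S p ≡ 0 → P S → P (S + 2 ^ p)) → ∀ n → P n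
bitInduction P P0 P+2^ = <-rec P step
  where
  step : ∀ n → (∀ {m} → m < n → P m) → P n
  step zero _ = P0
  step n@(suc _) rec with >0⇒∃bit≡1 n z<s
  ... | p , nₚ≡1 with bit≡1⇒split p nₚ≡1
  ...   | S , n≡S+2^p , Sₚ≡0 =
    subst P (sym n≡S+2^p) (P+2^ S p Sₚ≡0 (rec (subst (S <_) (sym n≡S+2^p) (m<m+n S (m^n>0 2 p)))))

sumBelow-cong : ∀ n {f g : ℕ → ℕ} → (∀ {i} → i < n → f i ≡ g i) → sumBelow n f ≡ sumBelow n g
sumBelow-cong zero _ = refl
sumBelow-cong (suc n) f≗g = cong₂ _+_ (sumBelow-cong n (f≗g ∘ m<n⇒m<1+n)) (f≗g ≤-refl)

sumBelow-zero : ∀ n {f : ℕ → ℕ} → (∀ {i} → i < n → f i ≡ 0) → sumBelow n f ≡ 0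
sumBelow-zero zero _ = refl
sumBelow-zero (suc n) f≡0 = cong₂ _+_ (sumBelow-zero n (f≡0 ∘ m<n⇒m<1+n)) (f≡0 ≤-refl)

sumBelow-+ : ∀ n (f g : ℕ → ℕ) → sumBelow n (λ i → f i + g i) ≡ sumBelow n f + sumBelow n g
sumBelow-+ zero f g = refl
sumBelow-+ (suc n) f g =
  trans (cong (_+ (f n + g n)) (sumBelow-+ n f g)) (interchange (sumBelow n f) (sumBelow n g) (f n) (g n))

sumBelow-*ʳ : ∀ n (f : ℕ → ℕ) K → sumBelow n f * K ≡ sumBelow n (λ i → f i * K)
sumBelow-*ʳ zero f K = refl
sumBelow-*ʳ (suc n) f K =
  trans (*-distribʳ-+ K (sumBelow n f) (f n)) (cong (_+ f n * K) (sumBelow-*ʳ n f K))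

sumBelow-extend : ∀ {m n} {f : ℕ → ℕ} → m ≤ n → (∀ {i} → m ≤ i → f i ≡ 0) →
  sumBelow n f ≡ sumBelow m f
sumBelow-extend {m} {n} {f} m≤n f≡0 = go (≤⇒≤′ m≤n)
  where
  go : ∀ {n} → m ≤′ n → sumBelow n f ≡ sumBelow m f
  go ≤′-refl = refl
  go (≤′-step m≤′n) = trans (cong₂ _+_ (go m≤′n) (f≡0 (≤′⇒≤ m≤′n))) (+-identityʳ (sumBelow m f))

sumBelow-δ : ∀ n {p} (f : ℕ → ℕ) → p < n → sumBelow n (λ i → δ i p * f i) ≡ f p
sumBelow-δ n {p} f p<n = begin
  sumBelow n δf                 ≡⟨ sumBelow-extend p<n (λ p<i → cong (_* f _) (δ-≢ (>⇒≢ p<i))) ⟩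
  sumBelow p δf + δ p p * f p   ≡⟨ cong₂ _+_ (sumBelow-zero p (λ i<p → cong (_* f _) (δ-≢ (<⇒≢ i<p))))
                                              (cong (_* f p) (δ-refl p)) ⟩
  f p + 0                       ≡⟨ +-identityʳ (f p) ⟩
  f p                           ∎
  where
  open ≡-Reasoning
  δf : ℕ → ℕ
  δf i = δ i p * f i

bit≡1⇒i<n : ∀ {n i} → bit n i ≡ 1 → i < n
bit≡1⇒i<n bit≡1 = ≰⇒> (λ n≤i → 0≢1+n (trans (sym (n≤i⇒bit≡0 n≤i)) bit≡1))

tilde≡sumBelow : ∀ (g : ℕ → ℕ) {n N} → n ≤ N → tilde g n ≡ sumBelow N (λ i → bit n i * 2 ^ g i)
tilde≡sumBelow g n≤N = sym (sumBelow-extend n≤N (λ n≤i → cong (_* 2 ^ g _) (n≤i⇒bit≡0 n≤i)))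

tilde-+2^ : ∀ (g : ℕ → ℕ) {S} p → bit S p ≡ 0 → tilde g (S + 2 ^ p) ≡ tilde g S + 2 ^ g p
tilde-+2^ g {S} p Sₚ≡0 = begin
  sumBelow N (λ i → bit N i * 2 ^ g i)
    ≡⟨ sumBelow-cong N (λ {i} _ → trans (cong (_* 2 ^ g i) (bit-+2^ p i Sₚ≡0))
                                          (*-distribʳ-+ (2 ^ g i) (bit S i) (δ i p))) ⟩
  sumBelow N (λ i → bit S i * 2 ^ g i + δ i p * 2 ^ g i)
    ≡⟨ sumBelow-+ N (λ i → bit S i * 2 ^ g i) (λ i → δ i p * 2 ^ g i) ⟩
  sumBelow N (λ i → bit S i * 2 ^ g i) + sumBelow N (λ i → δ i p * 2 ^ g i)
    ≡⟨ cong₂ _+_ (tilde≡sumBelow g (m≤m+n S (2 ^ p))) (sym (sumBelow-δ N (λ i → 2 ^ g i) p<N)) ⟨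
  tilde g S + 2 ^ g p ∎
  where
  open ≡-Reasoning
  N = S + 2 ^ p
  p<N : p < N
  p<N = bit≡1⇒i<n (trans (bit-+2^ p p Sₚ≡0) (cong₂ _+_ Sₚ≡0 (δ-refl p)))

tilde-bit : ∀ {g : ℕ → ℕ} → Injective _≡_ _≡_ g → ∀ S p → bit (tilde g S) (g p) ≡ bit S p
tilde-bit {g} g-inj = bitInduction (λ S → ∀ p → bit (tilde g S) (g p) ≡ bit S p) bit0
  λ S q S_q≡0 IH p → begin
    bit (tilde g (S + 2 ^ q)) (g p)          ≡⟨ cong (λ x → bit x (g p)) (tilde-+2^ g q S_q≡0) ⟩
    bit (tilde g S + 2 ^ g q) (g p)          ≡⟨ bit-+2^ (g q) (g p) (trans (IH q) S_q≡0) ⟩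
    bit (tilde g S) (g p) + δ (g p) (g q)    ≡⟨ cong₂ _+_ (IH p) (δ-injective-invariant g-inj p q) ⟩
    bit S p + δ p q                          ≡⟨ bit-+2^ q p S_q≡0 ⟨
    bit (S + 2 ^ q) p                        ∎
  where
  open ≡-Reasoning
  bit0 : ∀ p → bit 0 (g p) ≡ bit 0 p
  bit0 p = trans (n≤i⇒bit≡0 {i = g p} z≤n) (sym (n≤i⇒bit≡0 {i = p} z≤n))

tilde-inverseˡ : ∀ {g h : ℕ → ℕ} → (∀ x → g (h x) ≡ x) → ∀ n → tilde g (tilde h n) ≡ n
tilde-inverseˡ {g} {h} g∘h≗id = bitInduction (λ n → tilde g (tilde h n) ≡ n) refl
  λ S q S_q≡0 IH → begin
    tilde g (tilde h (S + 2 ^ q))      ≡⟨ cong (tilde g) (tilde-+2^ h q S_q≡0) ⟩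
    tilde g (tilde h S + 2 ^ h q)      ≡⟨ tilde-+2^ g (h q) (trans (tilde-bit h-inj S q) S_q≡0) ⟩
    tilde g (tilde h S) + 2 ^ g (h q)  ≡⟨ cong₂ (λ x y → x + 2 ^ y) IH (g∘h≗id q) ⟩
    S + 2 ^ q                          ∎
  where
  open ≡-Reasoning
  h-inj : Injective _≡_ _≡_ h
  h-inj {x} {y} hx≡hy = trans (sym (g∘h≗id x)) (trans (cong g hx≡hy) (g∘h≗id y))

tilde-*ʳ : ∀ (g : ℕ → ℕ) n K → sumBelow n (λ i → bit n i * (2 ^ g i * K)) ≡ tilde g n * K
tilde-*ʳ g n K =
  trans (sumBelow-cong n (λ {i} _ → sym (*-assoc (bit n i) (2 ^ g i) K))) (sym (sumBelow-*ʳ n _ K))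

accumulate : (ℕ → ℕ → ℕ) → ℕ → ℕ → ℕ → ℕ
accumulate G x a zero = a
accumulate G x a (suc i) = ifZero bit x i then accumulate G x a i else G i (accumulate G x a i)

accumulate-sum : ∀ (T : ℕ → ℕ) {G : ℕ → ℕ → ℕ} (w : ℕ → ℕ) → (∀ i a → T (G i a) ≡ T a + w i) →
  ∀ x a n → T (accumulate G x a n) ≡ T a + sumBelow n (λ i → bit x i * w i)
accumulate-sum T w TG≡ x a zero = sym (+-identityʳ (T a))
accumulate-sum T {G} w TG≡ x a (suc n) with bit x n | bit≡0⊎bit≡1 x n
... | _ | inj₁ refl = begin
  T (accumulate G x a n)          ≡⟨ accumulate-sum T w TG≡ x a n ⟩
  T a + Σ                         ≡⟨ cong (T a +_) (+-identityʳ Σ) ⟨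
  T a + (Σ + 0)                   ∎
  where
  open ≡-Reasoning
  Σ = sumBelow n (λ i → bit x i * w i)
... | _ | inj₂ refl = begin
  T (G n (accumulate G x a n))    ≡⟨ TG≡ n _ ⟩
  T (accumulate G x a n) + w n    ≡⟨ cong (_+ w n) (accumulate-sum T w TG≡ x a n) ⟩
  T a + Σ + w n                   ≡⟨ +-assoc (T a) Σ (w n) ⟩
  T a + (Σ + w n)                 ≡⟨ cong (λ y → T a + (Σ + y)) (*-identityˡ (w n)) ⟨
  T a + (Σ + 1 * w n)             ∎
  where
  open ≡-Reasoning
  Σ = sumBelow n (λ i → bit x i * w i)

accumulate-primRec : (G : ℕ → ℕ → ℕ → ℕ) → IsPrimRec 3 (λ { (z ∷ i ∷ a ∷ []) → G z i a }) →
  IsPrimRec 4 (λ { (n ∷ x ∷ a ∷ z ∷ []) → accumulate (G z) x a n })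
accumulate-primRec G G-primRec = rec-primRec _ (proj-primRec (# 1))
  (comp-primRec ifZero-primRec
    ( comp-primRec bit-primRec (proj-primRec (# 2) ∷ proj-primRec (# 0) ∷ [])
    ∷ proj-primRec (# 1)
    ∷ comp-primRec G-primRec (proj-primRec (# 4) ∷ proj-primRec (# 0) ∷ proj-primRec (# 1) ∷ [])
    ∷ []))
  (λ { (_ ∷ _ ∷ _ ∷ []) → refl }) (λ { _ (_ ∷ _ ∷ _ ∷ []) → refl })

module _ (c : ℕ ↔ ℕ) where
  open Copy c

  c←∘c→ : ∀ x → c← (c→ x) ≡ x
  c←∘c→ = Inverse.strictlyInverseʳ c

  SA^ : ℕ → ℕ → ℕ
  SA^ zero q = q
  SA^ (suc n) q = SA (SA^ n q)

  c←-SA^ : ∀ n q → c← (SA^ n q) ≡ c← q + n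
  c←-SA^ zero q = sym (+-identityʳ (c← q))
  c←-SA^ (suc n) q = trans (c←∘c→ _) (trans (cong suc (c←-SA^ n q)) (sym (+-suc (c← q) n)))

  -- The state of the carry loop records in its lowest bit whether the carry has been absorbed,
  -- so that the loop can idle until its fixed number of steps is used up.
  running finished : ℕ → ℕ
  running a = a * 2
  finished a = suc (a * 2)

  carryStep : ℕ → ℕ → ℕ
  carryStep q s =
    ifZero s % 2
    then (ifZero bit (s / 2) q then finished (s / 2 + 2 ^ q) else running (s / 2 ∸ 2 ^ q))
    else s

  carryStep-finished : ∀ q a → carryStep q (finished a) ≡ finished a
  carryStep-finished q a = ifZero-≡1 ([m+kn]%n≡m%n 1 a 2)

  carryStep-running : ∀ q a →
    carryStep q (running a) ≡ (ifZero bit a q then finished (a + 2 ^ q) else running (a ∸ 2 ^ q))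
  carryStep-running q a =
    cong₂ (λ b h → ifZero b
                   then (ifZero bit h q then finished (h + 2 ^ q) else running (h ∸ 2 ^ q))
                   else running a)
          (m*n%n≡0 a 2) (m*n/n≡m a 2)

  carry : ℕ → ℕ → ℕ → ℕ
  carry a q zero = running a
  carry a q (suc n) = carryStep (SA^ n q) (carry a q n)

  data CarryInvariant (a₀ q n : ℕ) : Set where
    carrying : ∀ a → carry a₀ q n ≡ running a →
               c̃⁻¹ a + 2 ^ (c← q + n) ≡ c̃⁻¹ a₀ + 2 ^ c← q → a + n ≤ a₀ → CarryInvariant a₀ q n
    done     : ∀ a → carry a₀ q n ≡ finished a →
               c̃⁻¹ a ≡ c̃⁻¹ a₀ + 2 ^ c← q → CarryInvariant a₀ q n

  carrying-suc : ∀ {a₀ q n} a → carry a₀ q n ≡ running a →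
    c̃⁻¹ a + 2 ^ (c← q + n) ≡ c̃⁻¹ a₀ + 2 ^ c← q → a + n ≤ a₀ → CarryInvariant a₀ q (suc n)
  carrying-suc {a₀} {q} {n} a carry≡ value bound with bit≡0⊎bit≡1 a (SA^ n q)
  ... | inj₁ aₙ≡0 = done (a + 2 ^ qₙ) carry≡′ value′
    where
    qₙ = SA^ n q
    carry≡′ : carryStep qₙ (carry a₀ q n) ≡ finished (a + 2 ^ qₙ)
    carry≡′ = trans (cong (carryStep qₙ) carry≡) (trans (carryStep-running qₙ a) (ifZero-≡0 aₙ≡0))
    value′ : c̃⁻¹ (a + 2 ^ qₙ) ≡ c̃⁻¹ a₀ + 2 ^ c← q
    value′ = trans (tilde-+2^ c← qₙ aₙ≡0) (trans (cong (λ x → c̃⁻¹ a + 2 ^ x) (c←-SA^ n q)) value)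
  ... | inj₂ aₙ≡1 with bit≡1⇒split (SA^ n q) aₙ≡1
  ...   | S , a≡S+2^qₙ , Sₙ≡0 = carrying S carry≡′ value′ bound′
    where
    qₙ = SA^ n q
    j = c← q + n
    carry≡′ : carryStep qₙ (carry a₀ q n) ≡ running S
    carry≡′ = begin
      carryStep qₙ (carry a₀ q n)   ≡⟨ cong (carryStep qₙ) carry≡ ⟩
      carryStep qₙ (running a)      ≡⟨ trans (carryStep-running qₙ a) (ifZero-≡1 aₙ≡1) ⟩
      running (a ∸ 2 ^ qₙ)          ≡⟨ cong (λ x → running (x ∸ 2 ^ qₙ)) a≡S+2^qₙ ⟩
      running (S + 2 ^ qₙ ∸ 2 ^ qₙ) ≡⟨ cong running (m+n∸n≡m S (2 ^ qₙ)) ⟩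
      running S                     ∎
      where open ≡-Reasoning
    value′ : c̃⁻¹ S + 2 ^ (c← q + suc n) ≡ c̃⁻¹ a₀ + 2 ^ c← q
    value′ = begin
      c̃⁻¹ S + 2 ^ (c← q + suc n)     ≡⟨ cong (λ x → c̃⁻¹ S + 2 ^ x) (+-suc (c← q) n) ⟩
      c̃⁻¹ S + (2 ^ j + (2 ^ j + 0))  ≡⟨ cong (λ x → c̃⁻¹ S + (2 ^ j + x)) (+-identityʳ (2 ^ j)) ⟩
      c̃⁻¹ S + (2 ^ j + 2 ^ j)        ≡⟨ +-assoc (c̃⁻¹ S) (2 ^ j) (2 ^ j) ⟨
      c̃⁻¹ S + 2 ^ j + 2 ^ j          ≡⟨ cong (λ x → c̃⁻¹ S + 2 ^ x + 2 ^ j) (c←-SA^ n q) ⟨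
      c̃⁻¹ S + 2 ^ c← qₙ + 2 ^ j      ≡⟨ cong (_+ 2 ^ j) (tilde-+2^ c← qₙ Sₙ≡0) ⟨
      c̃⁻¹ (S + 2 ^ qₙ) + 2 ^ j       ≡⟨ cong (λ x → c̃⁻¹ x + 2 ^ j) a≡S+2^qₙ ⟨
      c̃⁻¹ a + 2 ^ j                  ≡⟨ value ⟩
      c̃⁻¹ a₀ + 2 ^ c← q              ∎
      where open ≡-Reasoning
    bound′ : S + suc n ≤ a₀
    bound′ = begin
      S + suc n   ≡⟨ +-suc S n ⟩
      suc S + n   ≤⟨ +-monoˡ-≤ n (subst (S <_) (sym a≡S+2^qₙ) (m<m+n S (m^n>0 2 qₙ))) ⟩
      a + n       ≤⟨ bound ⟩
      a₀          ∎
      where open ≤-Reasoning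

  carry-invariant : ∀ a₀ q n → CarryInvariant a₀ q n
  carry-invariant a₀ q zero =
    carrying a₀ refl (cong (λ x → c̃⁻¹ a₀ + 2 ^ x) (+-identityʳ (c← q))) (≤-reflexive (+-identityʳ a₀))
  carry-invariant a₀ q (suc n) with carry-invariant a₀ q n
  ... | carrying a carry≡ value bound = carrying-suc a carry≡ value bound
  ... | done a carry≡ value =
    done a (trans (cong (carryStep (SA^ n q)) carry≡) (carryStep-finished (SA^ n q) a)) value

  _+Ã2^_ : ℕ → ℕ → ℕ
  a +Ã2^ q = carry a q (suc a) / 2

  c̃⁻¹-+Ã2^ : ∀ a q → c̃⁻¹ (a +Ã2^ q) ≡ c̃⁻¹ a + 2 ^ c← q
  c̃⁻¹-+Ã2^ a q with carry-invariant a q (suc a)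
  ... | carrying a′ _ _ a′+1+a≤a = contradiction (≤-trans (m≤n+m (suc a) a′) a′+1+a≤a) (<-irrefl refl)
  ... | done a′ carry≡ value =
    trans (cong (λ s → c̃⁻¹ (s / 2)) carry≡) (trans (cong c̃⁻¹ finished/2) value)
    where
    finished/2 : finished a′ / 2 ≡ a′
    finished/2 = trans (+-distrib-/-∣ʳ 1 {d = 2} (divides-refl a′)) (m*n/n≡m a′ 2)

  addShifted : ℕ → ℕ → ℕ → ℕ
  addShifted j x a = accumulate (λ i b → b +Ã2^ plusA i j) x a x

  c̃⁻¹-addShifted : ∀ j x a → c̃⁻¹ (addShifted j x a) ≡ c̃⁻¹ a + 2 ^ c← j * c̃⁻¹ x
  c̃⁻¹-addShifted j x a = begin
    c̃⁻¹ (addShifted j x a)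
      ≡⟨ accumulate-sum c̃⁻¹ (λ i → 2 ^ c← (plusA i j)) (λ i b → c̃⁻¹-+Ã2^ b (plusA i j)) x a x ⟩
    c̃⁻¹ a + sumBelow x (λ i → bit x i * 2 ^ c← (plusA i j))
      ≡⟨ cong (c̃⁻¹ a +_) (sumBelow-cong x (λ {i} _ → cong (bit x i *_) 2^c←[i+j])) ⟩
    c̃⁻¹ a + sumBelow x (λ i → bit x i * (2 ^ c← i * 2 ^ c← j))
      ≡⟨ cong (c̃⁻¹ a +_) (trans (tilde-*ʳ c← x (2 ^ c← j)) (*-comm (c̃⁻¹ x) (2 ^ c← j))) ⟩
    c̃⁻¹ a + 2 ^ c← j * c̃⁻¹ x ∎
    where
    open ≡-Reasoning
    2^c←[i+j] : ∀ {i} → 2 ^ c← (plusA i j) ≡ 2 ^ c← i * 2 ^ c← j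
    2^c←[i+j] {i} = trans (cong (2 ^_) (c←∘c→ (c← i + c← j))) (^-distribˡ-+-* 2 (c← i) (c← j))

  multiply : ℕ → ℕ → ℕ
  multiply x y = accumulate (λ j b → addShifted j y b) x 0 x

  c̃⁻¹-multiply : ∀ x y → c̃⁻¹ (multiply x y) ≡ c̃⁻¹ x * c̃⁻¹ y
  c̃⁻¹-multiply x y =
    trans (accumulate-sum c̃⁻¹ (λ j → 2 ^ c← j * c̃⁻¹ y) (λ j b → c̃⁻¹-addShifted j y b) x 0 x)
          (tilde-*ʳ c← x (c̃⁻¹ y))

  multiply≡timesÃ : ∀ x y → multiply x y ≡ timesÃ x y
  multiply≡timesÃ x y = begin
    multiply x y             ≡⟨ tilde-inverseˡ {c→} {c←} (Inverse.strictlyInverseˡ c) (multiply x y) ⟨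
    c̃ (c̃⁻¹ (multiply x y))  ≡⟨ cong c̃ (c̃⁻¹-multiply x y) ⟩
    c̃ (c̃⁻¹ x * c̃⁻¹ y)       ∎
    where open ≡-Reasoning

  module _ (SA-primRec : IsPrimRec₁ SA) (plusA-primRec : IsPrimRec₂ plusA) where

    SA^-primRec : IsPrimRec 2 (λ { (n ∷ q ∷ []) → SA^ n q })
    SA^-primRec = rec-primRec _ (proj-primRec (# 0)) (comp-primRec SA-primRec (proj-primRec (# 1) ∷ []))
      (λ { (_ ∷ []) → refl }) (λ { _ (_ ∷ []) → refl })

    carryStep-primRec : IsPrimRec₂ carryStep
    carryStep-primRec = primRec-≗
      (comp-primRec ifZero-primRec
        ( comp-primRec %2-primRec (proj-primRec (# 1) ∷ [])
        ∷ comp-primRec ifZero-primRec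
            ( comp-primRec bit-primRec (s/2 ∷ proj-primRec (# 0) ∷ [])
            ∷ comp-primRec suc-primRec (double (comp-primRec +-primRec (s/2 ∷ 2^q ∷ [])) ∷ [])
            ∷ double (comp-primRec ∸-primRec (s/2 ∷ 2^q ∷ []))
            ∷ [])
        ∷ proj-primRec (# 1)
        ∷ []))
      (λ { (_ ∷ _ ∷ []) → refl })
      where
      s/2 : IsPrimRec 2 (λ xs → lookup xs (# 1) / 2)
      s/2 = comp-primRec /2-primRec (proj-primRec (# 1) ∷ [])
      2^q : IsPrimRec 2 (λ xs → 2 ^ lookup xs (# 0))
      2^q = comp-primRec 2^-primRec (proj-primRec (# 0) ∷ [])
      double : {f : Vec ℕ 2 → ℕ} → IsPrimRec 2 f → IsPrimRec 2 (λ xs → f xs * 2)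
      double f-primRec = comp-primRec *-primRec (f-primRec ∷ const-primRec 2 ∷ [])

    carry-primRec : IsPrimRec 3 (λ { (n ∷ a ∷ q ∷ []) → carry a q n })
    carry-primRec = rec-primRec _
      (comp-primRec *-primRec (proj-primRec (# 0) ∷ const-primRec 2 ∷ []))
      (comp-primRec carryStep-primRec
        ( comp-primRec SA^-primRec (proj-primRec (# 0) ∷ proj-primRec (# 3) ∷ [])
        ∷ proj-primRec (# 1)
        ∷ []))
      (λ { (_ ∷ _ ∷ []) → refl }) (λ { _ (_ ∷ _ ∷ []) → refl })

    +Ã2^-primRec : IsPrimRec₂ _+Ã2^_
    +Ã2^-primRec = primRec-≗
      (comp-primRec /2-primRec
        (comp-primRec carry-primRec
          ( comp-primRec suc-primRec (proj-primRec (# 0) ∷ [])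
          ∷ proj-primRec (# 0)
          ∷ proj-primRec (# 1)
          ∷ [])
        ∷ []))
      (λ { (_ ∷ _ ∷ []) → refl })

    addShifted-primRec : IsPrimRec 3 (λ { (j ∷ x ∷ a ∷ []) → addShifted j x a })
    addShifted-primRec = primRec-≗
      (comp-primRec
        (accumulate-primRec (λ j i b → b +Ã2^ plusA i j)
          (primRec-≗
            (comp-primRec +Ã2^-primRec
              ( proj-primRec (# 2)
              ∷ comp-primRec plusA-primRec (proj-primRec (# 1) ∷ proj-primRec (# 0) ∷ [])
              ∷ []))
            (λ { (_ ∷ _ ∷ _ ∷ []) → refl })))
        (proj-primRec (# 1) ∷ proj-primRec (# 1) ∷ proj-primRec (# 2) ∷ proj-primRec (# 0) ∷ []))
      (λ { (_ ∷ _ ∷ _ ∷ []) → refl })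

    multiply-primRec : IsPrimRec₂ multiply
    multiply-primRec = primRec-≗
      (comp-primRec
        (accumulate-primRec (λ y j b → addShifted j y b)
          (primRec-≗
            (comp-primRec addShifted-primRec
              (proj-primRec (# 1) ∷ proj-primRec (# 0) ∷ proj-primRec (# 2) ∷ []))
            (λ { (_ ∷ _ ∷ _ ∷ []) → refl })))
        (proj-primRec (# 0) ∷ proj-primRec (# 0) ∷ const-primRec 0 ∷ proj-primRec (# 1) ∷ []))
      (λ { (_ ∷ _ ∷ []) → refl })

    timesÃ-primRec : IsPrimRec₂ timesÃ
    timesÃ-primRec = primRec-≗ multiply-primRec (λ { (x ∷ y ∷ []) → multiply≡timesÃ x y })

mainTheorem11 : (c : ℕ ↔ ℕ) →
    IsPrimRec₁ (Copy.SA c) →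
    IsPrimRec₂ (Copy.plusA c) →
    IsPrimRec₂ (Copy.timesÃ c)
mainTheorem11 = timesÃ-primRec
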